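{- Let $H$ be a graph containing an odd cycle and let $k\geq 2$. Then $f_k(n,H)\leq n+1$ for all $n\geq 2$.
   Context: All colourings are edge-colourings of the complete graph $K_n$; a colouring is proper if any two edges sharing a vertex receive different colours. Two copies of a graph $H$ in an edge-coloured $K_n$ are colour isomorphic if there is a graph isomorphism between them mapping each edge to an edge of the same colour. A $k$-repeat of $H$ is a collection of $k$ pairwise vertex-disjoint, pairwise colour-isomorphic copies of $H$. For integers $k,n\geq 2$ and a graph $H$, $f_k(n,H)$ is the smallest integer $C$ such that there is a proper edge-colouring of $K_n$ with $C$ colours containing no $k$-repeat of $H$. -}

module Defs where

open import Data.Nat using (ℕ; zero; suc; _+_; _*_)
open import Data.Fin using (Fin; zero; suc; inject₁; fromℕ)
open import Data.Product using (Σ; _×_; _,_; ∃)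
open import Relation.Binary.PropositionalEquality using (_≡_; _≢_)
open import Relation.Nullary using (¬_)
open import Function.Definitions using (Injective; Inverseᵇ)
open import Function.Bundles using (_⇔_)
open import Level using (0ℓ) renaming (suc to lsuc)

record Graph : Set₁ where
  field
    order : ℕ
    Adj   : Fin order → Fin order → Set
    sym   : ∀ {a b} → Adj a b → Adj b a
    irr   : ∀ {a} → ¬ Adj a a

open Graph public

-- H contains an odd cycle: a cycle subgraph c₀ c₁ … c_{2t+2} c₀ of length 2t+3
-- (odd, at least 3) given by distinct vertices.
ContainsOddCycle : Graph → Set
ContainsOddCycle H =
  Σ ℕ λ t → Σ (Fin (suc (2 * t + 2)) → Fin (order H)) λ c →
    Injective _≡_ _≡_ c
    × (∀ (i : Fin (2 * t + 2)) → Adj H (c (inject₁ i)) (c (suc i)))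
    × Adj H (c (fromℕ (2 * t + 2))) (c zero)

-- An edge-colouring of K_n with colours from Fin C (the colour of edge uv
-- is χ u v; values on the diagonal are irrelevant).
Colouring : ℕ → ℕ → Set
Colouring n C = Fin n → Fin n → Fin C

Symmetric : ∀ {n C} → Colouring n C → Set
Symmetric χ = ∀ u v → χ u v ≡ χ v u

Proper : ∀ {n C} → Colouring n C → Set
Proper χ = ∀ u v w → u ≢ v → u ≢ w → v ≢ w → χ u v ≢ χ u w

-- A copy of H in K_n, given by an injective map of its vertices
-- (K_n is complete, so every injection yields a copy).
record Copy (H : Graph) (n : ℕ) : Set where
  field
    emb    : Fin (order H) → Fin n
    emb-inj : Injective _≡_ _≡_ emb

open Copy public

-- Automorphism-induced isomorphism between two copies: a bijection σ of V(H)
-- preserving adjacency both ways, so x ↦ ψ(σ(φ⁻¹ x)) is a graph isomorphism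
-- between the copies; it must map each edge to an edge of the same colour.
ColourIsomorphic : ∀ {H n C} → Colouring n C → Copy H n → Copy H n → Set
ColourIsomorphic {H} χ φ ψ =
  Σ (Fin (order H) → Fin (order H)) λ σ →
  Σ (Fin (order H) → Fin (order H)) λ σ⁻ →
    Inverseᵇ _≡_ _≡_ σ σ⁻
    × (∀ a b → Adj H a b ⇔ Adj H (σ a) (σ b))
    × (∀ a b → Adj H a b → χ (emb φ a) (emb φ b) ≡ χ (emb ψ (σ a)) (emb ψ (σ b)))

VertexDisjoint : ∀ {H n} → Copy H n → Copy H n → Set
VertexDisjoint φ ψ = ∀ a b → emb φ a ≢ emb ψ b

Repeat : ∀ {n C} (k : ℕ) (H : Graph) → Colouring n C → Set
Repeat {n} k H χ =
  Σ (Fin k → Copy H n) λ cp →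
    ∀ i j → i ≢ j → VertexDisjoint (cp i) (cp j) × ColourIsomorphic χ (cp i) (cp j)

-- f_k(n,H) ≤ C: some proper colouring of K_n with (at most) C colours has no k-repeat of H.
fLe : ℕ → ℕ → Graph → ℕ → Set
fLe k n H C = Σ (Colouring n C) λ χ → Symmetric χ × Proper χ × ¬ Repeat k H χ

module Submission where

-- Choose an odd modulus m with
-- n ≤ m ≤ n + 1 and colour the edge uv of K_n by (u + v) mod m.  Since
-- m ≥ n, two edges at u with the same colour have the same other endpoint,
-- so the colouring is proper.  Suppose φ, ψ are vertex-disjoint copies of H
-- and σ is an automorphism of H making them colour isomorphic.  The label
-- d(a) = φ(a) − ψ(σ a) satisfies d(a) ≡ −d(b) (mod m) along every edge ab,
-- so d takes congruent values at the ends of a walk of even length.  Going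
-- around an odd cycle c₀ … c_{2t+2} c₀ therefore gives d(c₀) ≡ −d(c₀), and as
-- m is odd, d(c₀) ≡ 0, i.e. φ(c₀) = ψ(σ c₀): the copies meet.  Hence no two
-- copies of H form even a 2-repeat.

open import Data.Nat as ℕ using (ℕ; zero; suc; _<_; _≤_; z≤n; s≤s; NonZero)
import Data.Nat.Properties as ℕP
import Data.Nat.Divisibility as ℕD
import Data.Nat.Coprimality as ℕC
open import Data.Nat.DivMod using (_%_; _mod_)
open import Data.Integer using (ℤ; +_; 0ℤ; _+_; _-_; _*_; ∣_∣)
import Data.Integer.Properties as ℤP
open import Data.Integer.DivMod using (a≡a%ℕn+[a/ℕn]*n)
open import Data.Integer.Divisibility.Signed
open import Data.Integer.Coprimality using (coprime-divisor)
open import Data.Integer.Tactic.RingSolver using (solve-∀)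
open import Data.Fin as F using (Fin; toℕ; inject₁; inject≤; fromℕ)
import Data.Fin.Properties as FP
open import Data.Product using (Σ; _×_; _,_)
open import Data.Empty using (⊥-elim)
open import Relation.Nullary using (¬_)
open import Relation.Binary.PropositionalEquality
open import Defs hiding (sym)

module Congruence (m : ℕ) where

  infix 4 _≈_ _≈⁻_

  _≈_ : ℤ → ℤ → Set
  a ≈ b = + m ∣ a - b

  _≈⁻_ : ℤ → ℤ → Set
  a ≈⁻ b = + m ∣ a + b

  ≈-refl : ∀ a → a ≈ a
  ≈-refl a = divides 0ℤ (trans (ℤP.+-inverseʳ a) (sym (ℤP.*-zeroˡ (+ m))))

  opposite-opposite : ∀ a b c → a ≈⁻ b → b ≈⁻ c → a ≈ c
  opposite-opposite a b c ab bc =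
    subst (+ m ∣_) (telescope a b c) (∣m∣n⇒∣m-n {m = a + b} {n = b + c} ab bc)
    where
    telescope : ∀ a b c → (a + b) - (b + c) ≡ a - c
    telescope = solve-∀

  congruent-opposite : ∀ a b c → a ≈ b → b ≈⁻ c → a ≈⁻ c
  congruent-opposite a b c ab bc =
    subst (+ m ∣_) (telescope a b c) (∣m∣n⇒∣m+n {m = a - b} {n = b + c} ab bc)
    where
    telescope : ∀ a b c → (a - b) + (b + c) ≡ a + c
    telescope = solve-∀

  self-opposite : ℕC.Coprime m 2 → ∀ {a} → a ≈⁻ a → + m ∣ a
  self-opposite m⊥2 {a} aa = ∣ᵤ⇒∣ (coprime-divisor (+ m) (+ 2) a m⊥2
    (∣⇒∣ᵤ (subst (+ m ∣_) (sym (double a)) aa)))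
    where
    double : ∀ a → + 2 * a ≡ a + a
    double = solve-∀

  -- The relation between the end labels of a walk of length L whose
  -- consecutive labels are opposite: congruent for even L, opposite for odd L.
  WalkRel : ℕ → ℤ → ℤ → Set
  WalkRel zero          = _≈_
  WalkRel (suc zero)    = _≈⁻_
  WalkRel (suc (suc L)) = WalkRel L

  extend : ∀ L a b c → WalkRel L a b → b ≈⁻ c → WalkRel (suc L) a c
  extend zero          = congruent-opposite
  extend (suc zero)    = opposite-opposite
  extend (suc (suc L)) = extend L

  walk : ∀ L (f : Fin (suc L) → ℤ) →
         (∀ (i : Fin L) → f (inject₁ i) ≈⁻ f (F.suc i)) →
         WalkRel L (f F.zero) (f (fromℕ L))
  walk zero    f steps = ≈-refl (f F.zero)
  walk (suc L) f steps =
    extend L (f F.zero) (f (inject₁ (fromℕ L))) (f (fromℕ (suc L)))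
      (walk L (λ i → f (inject₁ i)) (λ i → steps (inject₁ i)))
      (steps (fromℕ L))

  even-walk : ∀ t {a b} → WalkRel (2 ℕ.* t) a b → a ≈ b
  even-walk zero    r = r
  even-walk (suc t) {a} {b} r =
    even-walk t (subst (λ L → WalkRel L a b) (ℕP.*-suc 2 t) r)

  -- A labelling of V(H) that is opposite across every edge vanishes modulo
  -- an odd m on an odd cycle: walking once around it, the first label is
  -- congruent to the last (even walk) and opposite to it (closing edge).
  odd-cycle-label : ℕC.Coprime m 2 → ∀ {H} → (d : Fin (order H) → ℤ) →
    (∀ a b → Adj H a b → d a ≈⁻ d b) →
    ((t , c , _) : ContainsOddCycle H) → + m ∣ d (c F.zero)
  odd-cycle-label m⊥2 d edge (t , c , _ , path , closing) =
    self-opposite m⊥2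
      (congruent-opposite (d (c F.zero)) (d (c last)) (d (c F.zero))
        around (edge _ _ closing))
    where
    last : Fin (suc (2 ℕ.* t ℕ.+ 2))
    last = fromℕ (2 ℕ.* t ℕ.+ 2)
    around : d (c F.zero) ≈ d (c last)
    around = even-walk t
      (subst (λ L → WalkRel L (d (c F.zero)) (d (c last))) (ℕP.+-comm (2 ℕ.* t) 2)
        (walk (2 ℕ.* t ℕ.+ 2) (λ i → d (c i)) (λ i → edge _ _ (path i))))

equal-residues⇒divides : ∀ m .{{_ : NonZero m}} a b → a % m ≡ b % m →
                         + m ∣ + a - + b
equal-residues⇒divides m a b same = divides (+ (a ℕ./ m) - + (b ℕ./ m)) (begin
  + a - + b
    ≡⟨ cong₂ _-_ (a≡a%ℕn+[a/ℕn]*n (+ a) m) (a≡a%ℕn+[a/ℕn]*n (+ b) m) ⟩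
  (+ (a % m) + + (a ℕ./ m) * + m) - (+ (b % m) + + (b ℕ./ m) * + m)
    ≡⟨ cong (λ r → (+ (a % m) + + (a ℕ./ m) * + m) - (r + + (b ℕ./ m) * + m))
            (cong +_ (sym same)) ⟩
  (+ (a % m) + + (a ℕ./ m) * + m) - (+ (a % m) + + (b ℕ./ m) * + m)
    ≡⟨ cancel-residue (+ (a % m)) (+ (a ℕ./ m)) (+ (b ℕ./ m)) (+ m) ⟩
  (+ (a ℕ./ m) - + (b ℕ./ m)) * + m ∎)
  where
  open ≡-Reasoning
  cancel-residue : ∀ r p q k → (r + p * k) - (r + q * k) ≡ (p - q) * k
  cancel-residue = solve-∀

multiple-below⇒zero : ∀ {m a} → m ℕD.∣ a → a < m → a ≡ 0
multiple-below⇒zero {a = zero}  _   _   = refl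
multiple-below⇒zero {a = suc a} m∣a a<m = ⊥-elim (ℕD.>⇒∤ a<m m∣a)

congruent-residues⇒≡ : ∀ {m x y} → x < m → y < m → + m ∣ + x - + y → x ≡ y
congruent-residues⇒≡ {m} {x} {y} x<m y<m m∣x-y =
  ℤP.+-injective (ℤP.i-j≡0⇒i≡j (+ x) (+ y)
    (ℤP.∣i∣≡0⇒i≡0 (multiple-below⇒zero (∣⇒∣ᵤ m∣x-y) distance<m)))
  where
  distance<m : ∣ + x - + y ∣ < m
  distance<m = subst (_< m) (cong ∣_∣ (sym (ℤP.[+m]-[+n]≡m⊖n x y)))
    (ℕP.≤-<-trans (ℤP.∣m⊝n∣≤m⊔n x y) (ℕP.⊔-lub x<m y<m))

module SumColouring {n C : ℕ} (m : ℕ) .{{_ : NonZero m}}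
                    (n≤m : n ≤ m) (m≤C : m ≤ C) where
  open Congruence m

  ⟦_⟧ : Fin n → ℤ
  ⟦ u ⟧ = + toℕ u

  χ : Colouring n C
  χ u v = inject≤ ((toℕ u ℕ.+ toℕ v) mod m) m≤C

  colour-value : ∀ u v → toℕ (χ u v) ≡ (toℕ u ℕ.+ toℕ v) % m
  colour-value u v = trans (FP.toℕ-inject≤ _ m≤C) (FP.toℕ-fromℕ< _)

  same-colour⇒congruent : ∀ u v u′ v′ → χ u v ≡ χ u′ v′ →
                          ⟦ u ⟧ + ⟦ v ⟧ ≈ ⟦ u′ ⟧ + ⟦ v′ ⟧
  same-colour⇒congruent u v u′ v′ same =
    subst₂ (λ p q → + m ∣ p - q) (ℤP.pos-+ (toℕ u) (toℕ v)) (ℤP.pos-+ (toℕ u′) (toℕ v′))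
      (equal-residues⇒divides m _ _
        (trans (sym (colour-value u v)) (trans (cong toℕ same) (colour-value u′ v′))))

  congruent⇒≡ : ∀ u v → ⟦ u ⟧ ≈ ⟦ v ⟧ → u ≡ v
  congruent⇒≡ u v u≈v = FP.toℕ-injective (congruent-residues⇒≡ (below u) (below v) u≈v)
    where
    below : ∀ w → toℕ w < m
    below w = ℕP.<-≤-trans (FP.toℕ<n w) n≤m

  symmetric : Symmetric χ
  symmetric u v = cong (λ s → inject≤ (s mod m) m≤C) (ℕP.+-comm (toℕ u) (toℕ v))

  proper : Proper χ
  proper u v w _ _ v≢w same = v≢w (congruent⇒≡ v w
    (subst (+ m ∣_) (cancel ⟦ u ⟧ ⟦ v ⟧ ⟦ w ⟧) (same-colour⇒congruent u v u w same)))
    where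
    cancel : ∀ a b c → (a + b) - (a + c) ≡ b - c
    cancel = solve-∀

  displacement : ∀ {H} → Copy H n → Copy H n → (Fin (order H) → Fin (order H)) →
                 Fin (order H) → ℤ
  displacement φ ψ σ a = ⟦ emb φ a ⟧ - ⟦ emb ψ (σ a) ⟧

  displacement-opposite : ∀ {H} (φ ψ : Copy H n) σ →
    (∀ a b → Adj H a b → χ (emb φ a) (emb φ b) ≡ χ (emb ψ (σ a)) (emb ψ (σ b))) →
    ∀ a b → Adj H a b → displacement φ ψ σ a ≈⁻ displacement φ ψ σ b
  displacement-opposite φ ψ σ preserves a b ab =
    subst (+ m ∣_) (regroup ⟦ emb φ a ⟧ ⟦ emb φ b ⟧ ⟦ emb ψ (σ a) ⟧ ⟦ emb ψ (σ b) ⟧)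
      (same-colour⇒congruent (emb φ a) (emb φ b) (emb ψ (σ a)) (emb ψ (σ b)) (preserves a b ab))
    where
    regroup : ∀ x y x′ y′ → (x + y) - (x′ + y′) ≡ (x - x′) + (y - y′)
    regroup = solve-∀

  -- For odd m, vertex-disjoint copies of a graph with an odd cycle are never
  -- colour isomorphic: the displacement vanishes on the cycle.
  disjoint⇒not-colour-isomorphic : ℕC.Coprime m 2 → ∀ {H} → ContainsOddCycle H →
    (φ ψ : Copy H n) → VertexDisjoint φ ψ → ¬ ColourIsomorphic χ φ ψ
  disjoint⇒not-colour-isomorphic m⊥2 {H} cycle@(_ , c , _) φ ψ disjoint
                                 (σ , _ , _ , _ , preserves) =
    disjoint (c F.zero) (σ (c F.zero))
      (congruent⇒≡ (emb φ (c F.zero)) (emb ψ (σ (c F.zero)))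
        (odd-cycle-label m⊥2 {H} (displacement φ ψ σ)
          (displacement-opposite φ ψ σ preserves) cycle))

  no-repeat : ℕC.Coprime m 2 → ∀ {H} → ContainsOddCycle H → ∀ {k} → 2 ≤ k → ¬ Repeat k H χ
  no-repeat m⊥2 cycle (s≤s (s≤s _)) (copy , pairwise)
    with pairwise F.zero (F.suc F.zero) (λ ())
  ... | disjoint , isomorphic =
    disjoint⇒not-colour-isomorphic m⊥2 cycle (copy F.zero) (copy (F.suc F.zero))
      disjoint isomorphic

odd-coprime-2 : ∀ h → ℕC.Coprime (suc (2 ℕ.* h)) 2
odd-coprime-2 h {d} (d∣odd , d∣2) = ℕD.∣1⇒≡1
  (ℕD.∣m+n∣m⇒∣n (subst (d ℕD.∣_) (ℕP.+-comm 1 (2 ℕ.* h)) d∣odd) (ℕD.∣m⇒∣m*n h d∣2))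

odd-between : ∀ n → Σ ℕ λ h → n ≤ suc (2 ℕ.* h) × suc (2 ℕ.* h) ≤ suc n
odd-between zero          = 0 , z≤n , ℕP.≤-refl
odd-between (suc zero)    = 0 , ℕP.≤-refl , ℕP.n≤1+n 1
odd-between (suc (suc n)) with odd-between n
... | h , lower , upper =
  suc h , subst (suc (suc n) ≤_) next-odd (s≤s (s≤s lower))
        , subst (_≤ suc (suc (suc n))) next-odd (s≤s (s≤s upper))
  where
  next-odd : 2 ℕ.+ suc (2 ℕ.* h) ≡ suc (2 ℕ.* suc h)
  next-odd = cong suc (sym (ℕP.*-suc 2 h))

theorem2p3 : (H : Graph) → ContainsOddCycle H → (k : ℕ) → 2 ≤ k →
    (n : ℕ) → 2 ≤ n → fLe k n H (suc n)
theorem2p3 H cycle k 2≤k n _ with odd-between n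
... | h , n≤m , m≤1+n = χ , symmetric , proper , no-repeat (odd-coprime-2 h) cycle 2≤k
  where open SumColouring (suc (2 ℕ.* h)) n≤m m≤1+n
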